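{- There exists a strictly Neumaier graph with parameters $(v,k,\lambda;e,s)=(25,12,5;2,5)$.
   Context: All graphs are finite and simple. A graph is $k$-regular if every vertex has exactly $k$ neighbours. A regular graph is $\lambda$-edge-regular if it has at least one edge and every pair of adjacent vertices has exactly $\lambda$ common neighbours; it is $\mu$-co-edge-regular if it is not complete and every pair of distinct non-adjacent vertices has exactly $\mu$ common neighbours. A graph is strongly regular if it is both edge-regular and co-edge-regular. A clique $C$ in a regular graph is $e$-regular (for an integer $e>0$) if every vertex outside $C$ has exactly $e$ neighbours in $C$. A Neumaier graph with parameters $(v,k,\lambda;e,s)$ is a non-complete graph on $v$ vertices that is $k$-regular and $\lambda$-edge-regular and contains an $e$-regular clique of size $s$. A strictly Neumaier graph is a Neumaier graph that is not strongly regular. -}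

module Defs where

open import Data.Nat using (ℕ; zero; suc; _+_; _>_)
open import Data.Fin using (Fin; zero; suc)
open import Data.Bool using (Bool; true; false; _∧_; if_then_else_)
open import Data.Product using (Σ; ∃; ∃-syntax; _×_; _,_)
open import Relation.Binary.PropositionalEquality using (_≡_; _≢_)
open import Relation.Nullary using (¬_)

countF : ∀ {n} → (Fin n → Bool) → ℕ
countF {zero}  P = 0
countF {suc n} P = (if P zero then 1 else 0) + countF (λ i → P (suc i))

record Graph (n : ℕ) : Set where
  field
    adj    : Fin n → Fin n → Bool
    sym    : ∀ x y → adj x y ≡ adj y x
    irrefl : ∀ x → adj x x ≡ false
open Graph public

module _ {n : ℕ} (G : Graph n) where

  degree : Fin n → ℕ
  degree x = countF (adj G x)

  common : Fin n → Fin n → ℕ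
  common x y = countF (λ z → adj G x z ∧ adj G y z)

  IsRegular : ℕ → Set
  IsRegular k = ∀ x → degree x ≡ k

  IsComplete : Set
  IsComplete = ∀ x y → x ≢ y → adj G x y ≡ true

  HasEdge : Set
  HasEdge = ∃[ x ] ∃[ y ] (adj G x y ≡ true)

  IsEdgeRegular : ℕ → Set
  IsEdgeRegular lam =
    (∃[ k ] IsRegular k) × HasEdge ×
    (∀ x y → adj G x y ≡ true → common x y ≡ lam)

  IsCoEdgeRegular : ℕ → Set
  IsCoEdgeRegular mu =
    (∃[ k ] IsRegular k) × ¬ IsComplete ×
    (∀ x y → x ≢ y → adj G x y ≡ false → common x y ≡ mu)

  IsStronglyRegular : Set
  IsStronglyRegular = (∃[ lam ] IsEdgeRegular lam) × (∃[ mu ] IsCoEdgeRegular mu)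

  IsClique : (Fin n → Bool) → Set
  IsClique C = ∀ x y → C x ≡ true → C y ≡ true → x ≢ y → adj G x y ≡ true

  IsRegularClique : ℕ → (Fin n → Bool) → Set
  IsRegularClique e C =
    e > 0 × IsClique C ×
    (∀ x → C x ≡ false → countF (λ z → C z ∧ adj G x z) ≡ e)

IsNeumaier : (v : ℕ) → Graph v → ℕ → ℕ → ℕ → ℕ → Set
IsNeumaier v G k lam e s =
  ¬ IsComplete G × IsRegular G k × IsEdgeRegular G lam ×
  (∃[ C ] (IsRegularClique G e C × countF C ≡ s))

IsStrictlyNeumaier : (v : ℕ) → Graph v → ℕ → ℕ → ℕ → ℕ → Set
IsStrictlyNeumaier v G k lam e s = IsNeumaier v G k lam e s × ¬ IsStronglyRegular G

{-# OPTIONS --safe #-}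
module Submission where

-- Every defining property of a Neumaier graph, once the clique is named, quantifies
-- over finitely many vertices only, so for an explicit graph it is decided by
-- evaluation. The clique {0,…,4} of the graph below is 2-regular, while non-adjacent
-- pairs have 4, 6 or 8 common neighbours (8 for {0,10}, 4 for {0,14}), so the graph
-- is not co-edge-regular.

open import Defs hiding (sym)
open import Data.Bool using (Bool; true; false; _∧_)
open import Data.Bool.ListAction using (any)
open import Data.Bool.Properties using () renaming (_≟_ to _≟ᵇ_)
open import Data.Fin using (Fin; zero; toℕ; #_)
open import Data.Fin.Properties using (all?; any?) renaming (_≟_ to _≟ᶠ_)
open import Data.List using (List; []; _∷_)
open import Data.Nat using (ℕ; zero; suc; _≡ᵇ_; _<ᵇ_; _<?_)
open import Data.Nat.Properties using (_≟_)
open import Data.Product using (Σ; ∃-syntax; _,_)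
open import Data.Vec using (Vec; []; _∷_; lookup)
open import Relation.Binary.PropositionalEquality using (_≡_; _≢_; refl; trans; sym)
open import Relation.Nullary using (¬_; Dec; yes; no; ¬?; _×-dec_; _→-dec_)
open import Relation.Nullary.Decidable using (from-yes)

regular? : ∀ {n} (G : Graph n) → Dec (∃[ k ] IsRegular G k)
regular? {zero}  G = yes (0 , λ ())
regular? {suc n} G with all? (λ x → degree G x ≟ degree G zero)
... | yes regular = yes (_ , regular)
... | no  ¬regular =
  no λ (_ , regular) → ¬regular λ x → trans (regular x) (sym (regular zero))

module _ {n : ℕ} (G : Graph n) where

  isComplete? : Dec (IsComplete G)
  isComplete? = all? λ x → all? λ y → ¬? (x ≟ᶠ y) →-dec adj G x y ≟ᵇ true

  isRegular? : ∀ k → Dec (IsRegular G k)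
  isRegular? k = all? λ x → degree G x ≟ k

  hasEdge? : Dec (HasEdge G)
  hasEdge? = any? λ x → any? λ y → adj G x y ≟ᵇ true

  isEdgeRegular? : ∀ lam → Dec (IsEdgeRegular G lam)
  isEdgeRegular? lam =
    regular? G ×-dec hasEdge? ×-dec
    all? λ x → all? λ y → adj G x y ≟ᵇ true →-dec common G x y ≟ lam

  isClique? : ∀ C → Dec (IsClique G C)
  isClique? C =
    all? λ x → all? λ y →
      C x ≟ᵇ true →-dec C y ≟ᵇ true →-dec ¬? (x ≟ᶠ y) →-dec adj G x y ≟ᵇ true

  isRegularClique? : ∀ e C → Dec (IsRegularClique G e C)
  isRegularClique? e C =
    0 <? e ×-dec isClique? C ×-dec
    all? λ x → C x ≟ᵇ false →-dec countF (λ z → C z ∧ adj G x z) ≟ e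

  nonEdgesWithDistinctCommon⇒¬IsStronglyRegular :
    ∀ {x y x′ y′} → x ≢ y → adj G x y ≡ false → x′ ≢ y′ → adj G x′ y′ ≡ false →
    common G x y ≢ common G x′ y′ → ¬ IsStronglyRegular G
  nonEdgesWithDistinctCommon⇒¬IsStronglyRegular x≢y xy x′≢y′ x′y′ distinct
    (_ , _ , _ , _ , common≡μ) =
    distinct (trans (common≡μ _ _ x≢y xy) (sym (common≡μ _ _ x′≢y′ x′y′)))

neighbourhoods : Vec (List ℕ) 25
neighbourhoods =
    (1 ∷ 2 ∷ 3 ∷ 4 ∷ 5 ∷ 6 ∷ 7 ∷ 8 ∷ 9 ∷ 13 ∷ 17 ∷ 21 ∷ [])
  ∷ (0 ∷ 2 ∷ 3 ∷ 4 ∷ 5 ∷ 9 ∷ 10 ∷ 11 ∷ 12 ∷ 14 ∷ 18 ∷ 22 ∷ [])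
  ∷ (0 ∷ 1 ∷ 3 ∷ 4 ∷ 6 ∷ 10 ∷ 13 ∷ 14 ∷ 15 ∷ 16 ∷ 19 ∷ 23 ∷ [])
  ∷ (0 ∷ 1 ∷ 2 ∷ 4 ∷ 7 ∷ 11 ∷ 15 ∷ 17 ∷ 18 ∷ 19 ∷ 20 ∷ 24 ∷ [])
  ∷ (0 ∷ 1 ∷ 2 ∷ 3 ∷ 8 ∷ 12 ∷ 16 ∷ 20 ∷ 21 ∷ 22 ∷ 23 ∷ 24 ∷ [])
  ∷ (0 ∷ 1 ∷ 6 ∷ 7 ∷ 8 ∷ 10 ∷ 11 ∷ 13 ∷ 14 ∷ 16 ∷ 22 ∷ 23 ∷ [])
  ∷ (0 ∷ 2 ∷ 5 ∷ 8 ∷ 9 ∷ 10 ∷ 14 ∷ 15 ∷ 17 ∷ 20 ∷ 23 ∷ 24 ∷ [])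
  ∷ (0 ∷ 3 ∷ 5 ∷ 8 ∷ 9 ∷ 11 ∷ 12 ∷ 13 ∷ 15 ∷ 18 ∷ 22 ∷ 24 ∷ [])
  ∷ (0 ∷ 4 ∷ 5 ∷ 6 ∷ 7 ∷ 10 ∷ 12 ∷ 15 ∷ 16 ∷ 18 ∷ 20 ∷ 21 ∷ [])
  ∷ (0 ∷ 1 ∷ 6 ∷ 7 ∷ 10 ∷ 11 ∷ 12 ∷ 17 ∷ 18 ∷ 20 ∷ 21 ∷ 24 ∷ [])
  ∷ (1 ∷ 2 ∷ 5 ∷ 6 ∷ 8 ∷ 9 ∷ 12 ∷ 13 ∷ 18 ∷ 19 ∷ 21 ∷ 23 ∷ [])
  ∷ (1 ∷ 3 ∷ 5 ∷ 7 ∷ 9 ∷ 12 ∷ 14 ∷ 16 ∷ 17 ∷ 19 ∷ 23 ∷ 24 ∷ [])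
  ∷ (1 ∷ 4 ∷ 7 ∷ 8 ∷ 9 ∷ 10 ∷ 11 ∷ 13 ∷ 16 ∷ 19 ∷ 20 ∷ 22 ∷ [])
  ∷ (0 ∷ 2 ∷ 5 ∷ 7 ∷ 10 ∷ 12 ∷ 15 ∷ 16 ∷ 17 ∷ 19 ∷ 21 ∷ 22 ∷ [])
  ∷ (1 ∷ 2 ∷ 5 ∷ 6 ∷ 11 ∷ 15 ∷ 16 ∷ 18 ∷ 19 ∷ 20 ∷ 22 ∷ 24 ∷ [])
  ∷ (2 ∷ 3 ∷ 6 ∷ 7 ∷ 8 ∷ 13 ∷ 14 ∷ 16 ∷ 17 ∷ 18 ∷ 21 ∷ 24 ∷ [])
  ∷ (2 ∷ 4 ∷ 5 ∷ 8 ∷ 11 ∷ 12 ∷ 13 ∷ 14 ∷ 15 ∷ 17 ∷ 20 ∷ 23 ∷ [])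
  ∷ (0 ∷ 3 ∷ 6 ∷ 9 ∷ 11 ∷ 13 ∷ 15 ∷ 16 ∷ 19 ∷ 20 ∷ 21 ∷ 23 ∷ [])
  ∷ (1 ∷ 3 ∷ 7 ∷ 8 ∷ 9 ∷ 10 ∷ 14 ∷ 15 ∷ 19 ∷ 20 ∷ 21 ∷ 22 ∷ [])
  ∷ (2 ∷ 3 ∷ 10 ∷ 11 ∷ 12 ∷ 13 ∷ 14 ∷ 17 ∷ 18 ∷ 20 ∷ 22 ∷ 23 ∷ [])
  ∷ (3 ∷ 4 ∷ 6 ∷ 8 ∷ 9 ∷ 12 ∷ 14 ∷ 16 ∷ 17 ∷ 18 ∷ 19 ∷ 24 ∷ [])
  ∷ (0 ∷ 4 ∷ 8 ∷ 9 ∷ 10 ∷ 13 ∷ 15 ∷ 17 ∷ 18 ∷ 22 ∷ 23 ∷ 24 ∷ [])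
  ∷ (1 ∷ 4 ∷ 5 ∷ 7 ∷ 12 ∷ 13 ∷ 14 ∷ 18 ∷ 19 ∷ 21 ∷ 23 ∷ 24 ∷ [])
  ∷ (2 ∷ 4 ∷ 5 ∷ 6 ∷ 10 ∷ 11 ∷ 16 ∷ 17 ∷ 19 ∷ 21 ∷ 22 ∷ 24 ∷ [])
  ∷ (3 ∷ 4 ∷ 6 ∷ 7 ∷ 9 ∷ 11 ∷ 14 ∷ 15 ∷ 20 ∷ 21 ∷ 22 ∷ 23 ∷ [])
  ∷ []

graph : Graph 25
graph = record
  { adj    = adjacency
  ; sym    = from-yes (all? λ x → all? λ y → adjacency x y ≟ᵇ adjacency y x)
  ; irrefl = from-yes (all? λ x → adjacency x x ≟ᵇ false)
  }
  where
  adjacency : Fin 25 → Fin 25 → Bool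
  adjacency x y = any (toℕ y ≡ᵇ_) (lookup neighbourhoods x)

clique : Fin 25 → Bool
clique x = toℕ x <ᵇ 5

mainTheorem2 : Σ (Graph 25) (λ G → IsStrictlyNeumaier 25 G 12 5 2 5)
mainTheorem2 = graph , neumaier , notStronglyRegular
  where
  neumaier : IsNeumaier 25 graph 12 5 2 5
  neumaier =
    from-yes (¬? (isComplete? graph)) ,
    from-yes (isRegular? graph 12) ,
    from-yes (isEdgeRegular? graph 5) ,
    clique , from-yes (isRegularClique? graph 2 clique) , refl

  notStronglyRegular : ¬ IsStronglyRegular graph
  notStronglyRegular =
    nonEdgesWithDistinctCommon⇒¬IsStronglyRegular graph {# 0} {# 10} {# 0} {# 14}
      (λ ()) refl (λ ()) refl (λ ())
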